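{- Let $q\in\mathbb{C}$ with $0<|q|<1$ and $a\in\mathbb{C}$. Let $F(z)=\sum_{n=0}^{\infty}a_nz^n\in\mathbb{C}[[z]]$ and, for $k\ge0$, let $F_k(z)=\sum_{i=0}^ka_iz^i$. Suppose that $$\frac{F(z)}{1-az}=\sum_{n=0}^{\infty}\frac{c_nz^{n}}{1-azq^n}\quad\text{in }\mathbb{C}[[z]]$$ with $c_n\in\mathbb{C}$. Then $c_0=a_0$ and for $n\ge1$, $$c_n=\sum_{k=0}^{n-1}g_{n-k}(q)\,q^{(n-k)k}\,[z^{n}]\left\{\frac{F(z)-F_k(z)}{1-az}\right\},$$ where the polynomials $g_n(q)$ ($n\ge1$) are defined recursively by $$g_n(q)=1-\sum_{i=1}^{n-1}g_{n-i}(q)\,q^{(n-i)i}$$ (so $g_1(q)=1$).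
   Context: $[z^m]\{f(z)\}$ denotes the coefficient of $z^m$ in $f\in\mathbb{C}[[z]]$; $1/(1-az)$ and $1/(1-azq^n)$ are expanded as formal power series in $z$. -}

module Defs where

open import Level using (Level)
open import Data.Nat as ℕ using (ℕ; zero; suc; _∸_; _≤ᵇ_)
open import Data.Bool using (if_then_else_)
open import Algebra.Bundles using (CommutativeRing; Semiring)

-- Formal power series over a commutative ring R, represented by their
-- coefficient sequences ℕ → Carrier (coefficient of z^m at index m).
module PS {c ℓ : Level} (R : CommutativeRing c ℓ) where
  open CommutativeRing R public
  open import Algebra.Definitions.RawSemiring (Semiring.rawSemiring semiring) public using (_^_)

  Series : Set c
  Series = ℕ → Carrier

  sumTo : ℕ → (ℕ → Carrier) → Carrier
  sumTo zero    f = 0#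
  sumTo (suc n) f = sumTo n f + f n

  _⊛_ : Series → Series → Series
  (f ⊛ g) m = sumTo (suc m) (λ j → f j * g (m ∸ j))

  -- 1/(1 - b z) = Σ_m b^m z^m as a formal power series
  geom : Carrier → Series
  geom b m = b ^ m

  _·_ : Carrier → Series → Series
  (s · f) m = s * f m

  shift : ℕ → Series → Series
  shift zero    f m       = f m
  shift (suc n) f zero    = 0#
  shift (suc n) f (suc m) = shift n f m

  -- Σ_n t n for a family with t n ∈ z^n C[[z]] (formally summable):
  -- coefficient of z^m is Σ_{n ≤ m} [z^m] t n.
  sumSeries : (ℕ → Series) → Series
  sumSeries t m = sumTo (suc m) (λ n → t n m)

  trunc : ℕ → Series → Series
  trunc k F i = if i ≤ᵇ k then F i else 0#

  tailFrom : ℕ → Series → Series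
  tailFrom k F i = F i - trunc k F i

  -- g_n(q), n ≥ 1:  g_n = 1 - Σ_{i=1}^{n-1} g_{n-i} q^{(n-i) i}.
  -- Computed with fuel; gFuel f n is correct whenever f ≥ n.
  gFuel : Carrier → ℕ → ℕ → Carrier
  gFuel q zero    n = 0#
  gFuel q (suc f) n =
    1# - sumTo (n ∸ 1) (λ j → gFuel q f (n ∸ suc j) * q ^ ((n ∸ suc j) ℕ.* suc j))

  g : Carrier → ℕ → Carrier
  g q n = gFuel q n n

module Submission where

-- Write B = A/(1 - az), so B_m = Σ_{j ≤ m} A_j a^{m-j}, and let
-- E_m = Σ_{j ≤ m} C_j (a q^j)^{m-j} be the z^m-coefficient of the right-hand
-- side Σ_n C_n z^n/(1 - a q^n z); the hypothesis says B_m ≈ E_m for all m.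
-- With the weights w_n(k) = g_{n-k} q^{(n-k)k}, the proof rests on:
--   (1) the recurrence for g says exactly  Σ_{k<n} w_n(k) = 1  for n ≥ 1;
--   (2) [z^n] (A - A_k)/(1 - az) = B_n - a^{n-k} B_k  for k ≤ n;
--   (3) inversion:  Σ_{k<n} w_n(k) a^{n-k} E_k = Σ_{j<n} C_j (a q^j)^{n-j},
--       for every sequence C, by exchanging the two sums and applying (1)
--       to the inner sum, after the factorisation
--       w_n(j+i) a^{n-j-i} (a q^j)^i = (a q^j)^{n-j} w_{n-j}(i).
-- By (1) and (2) the claimed right-hand side is B_n - Σ_{k<n} w_n(k) a^{n-k} B_k;
-- replacing B by E and using (3) it is E_n - Σ_{j<n} C_j (a q^j)^{n-j} = C_n.

open import Defs
open import Level using (Level)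
open import Data.Nat using (ℕ; zero; suc; _∸_; _≤_)
open import Data.Product using (_×_; _,_)
open import Algebra.Bundles using (CommutativeRing)

import Data.Nat as N
import Data.Nat.Properties as NP
open import Data.Nat using (s≤s; _≤ᵇ_)
open import Data.Bool using (true; false)
open import Data.Unit using (tt)
open import Data.Empty using (⊥-elim)
open import Relation.Binary.PropositionalEquality as P using (_≡_)
import Relation.Binary.Reasoning.Setoid
import Algebra.Solver.CommutativeMonoid as CommutativeMonoidSolver
import Algebra.Properties.Ring as RingProperties
import Algebra.Properties.AbelianGroup as AbelianGroupProperties
import Algebra.Properties.CommutativeSemigroup as CommutativeSemigroupProperties
import Algebra.Properties.CommutativeSemiring.Exp as ExpProperties

∸-suc : ∀ m j → j N.< m → m ∸ j ≡ suc (m ∸ suc j)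
∸-suc (suc m) zero    _       = P.refl
∸-suc (suc m) (suc j) (s≤s p) = ∸-suc m j p

module Development {c ℓ : Level} (R : CommutativeRing c ℓ) where
  open PS R
  open Relation.Binary.Reasoning.Setoid setoid
  open ExpProperties commutativeSemiring using (^-homo-*; ^-distrib-*; ^-assocʳ; ^-congʳ)
  open RingProperties ring using (-0#≈0#; -‿distribˡ-*; -‿distribʳ-*)
  open AbelianGroupProperties +-abelianGroup using (⁻¹-∙-comm)
  open CommutativeSemigroupProperties +-commutativeSemigroup using (interchange)
  module M = CommutativeMonoidSolver *-commutativeMonoid
  open M using (_⊜_) renaming (_⊕_ to _⊙_)

  sum-cong : ∀ n {f h : ℕ → Carrier} → (∀ i → i N.< n → f i ≈ h i) → sumTo n f ≈ sumTo n h
  sum-cong zero    e = refl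
  sum-cong (suc n) e = +-cong (sum-cong n (λ i p → e i (NP.m<n⇒m<1+n p))) (e n NP.≤-refl)

  sum-length : ∀ {m m'} (f : ℕ → Carrier) → m ≡ m' → sumTo m f ≈ sumTo m' f
  sum-length f P.refl = refl

  sum-+ : ∀ n (f h : ℕ → Carrier) → sumTo n (λ i → f i + h i) ≈ sumTo n f + sumTo n h
  sum-+ zero    f h = sym (+-identityʳ 0#)
  sum-+ (suc n) f h = trans (+-cong (sum-+ n f h) refl) (interchange _ _ _ _)

  sum-*ˡ : ∀ n x (f : ℕ → Carrier) → sumTo n (λ i → x * f i) ≈ x * sumTo n f
  sum-*ˡ zero    x f = sym (zeroʳ x)
  sum-*ˡ (suc n) x f = trans (+-cong (sum-*ˡ n x f) refl) (sym (distribˡ x _ _))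

  sum-*ʳ : ∀ n x (f : ℕ → Carrier) → sumTo n (λ i → f i * x) ≈ sumTo n f * x
  sum-*ʳ n x f = trans (sum-cong n (λ i _ → *-comm (f i) x)) (trans (sum-*ˡ n x f) (*-comm x _))

  sum-neg : ∀ n (f : ℕ → Carrier) → sumTo n (λ i → - f i) ≈ - sumTo n f
  sum-neg zero    f = sym -0#≈0#
  sum-neg (suc n) f = trans (+-cong (sum-neg n f) refl) (⁻¹-∙-comm _ _)

  sum-head : ∀ n (f : ℕ → Carrier) → sumTo (suc n) f ≈ f 0 + sumTo n (λ i → f (suc i))
  sum-head zero    f = +-comm _ _
  sum-head (suc n) f = trans (+-cong (sum-head n f) refl) (+-assoc _ _ _)

  sum-vanishing-tail : ∀ m d (f : ℕ → Carrier) → (∀ i → m ≤ i → f i ≈ 0#) →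
                       sumTo (d N.+ m) f ≈ sumTo m f
  sum-vanishing-tail m zero    f z = refl
  sum-vanishing-tail m (suc d) f z =
    trans (+-cong (sum-vanishing-tail m d f z) (z _ (NP.m≤n+m m d))) (+-identityʳ _)

  sum-exchange : ∀ n (f : ℕ → ℕ → Carrier) →
                 sumTo n (λ k → sumTo (suc k) (λ j → f j k)) ≈
                 sumTo n (λ j → sumTo (n ∸ j) (λ i → f j (j N.+ i)))
  sum-exchange zero    f = refl
  sum-exchange (suc n) f = begin
      sumTo n (λ k → sumTo (suc k) (λ j → f j k)) + sumTo (suc n) (λ j → f j n)
    ≈⟨ +-cong (trans (sum-exchange n f) (sym (+-identityʳ _))) refl ⟩
      (Inner n + 0#) + sumTo (suc n) (λ j → f j n)
    ≈⟨ +-cong (+-cong refl (sum-length _ (P.sym (NP.n∸n≡0 n)))) refl ⟩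
      (Inner n + sumTo (n ∸ n) (λ i → f n (n N.+ i))) + sumTo (suc n) (λ j → f j n)
    ≈⟨ sym (sum-+ (suc n) _ _) ⟩
      sumTo (suc n) (λ j → sumTo (n ∸ j) (λ i → f j (j N.+ i)) + f j n)
    ≈⟨ sum-cong (suc n) (λ j p → extend j (NP.≤-pred p)) ⟩
      Inner (suc n) ∎
    where
    Inner : ℕ → Carrier
    Inner m = sumTo m (λ j → sumTo (m ∸ j) (λ i → f j (j N.+ i)))
    -- the new column entry f j n is the last term of the j-th inner sum
    extend : ∀ j → j ≤ n →
             sumTo (n ∸ j) (λ i → f j (j N.+ i)) + f j n ≈ sumTo (suc n ∸ j) (λ i → f j (j N.+ i))
    extend j j≤n = trans
      (+-cong refl (reflexive (P.cong (f j) (P.sym (NP.m+[n∸m]≡n j≤n)))))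
      (sum-length _ (P.sym (∸-suc (suc n) j (s≤s j≤n))))

  sum-top : ∀ n (x y : ℕ → Carrier) →
            sumTo (suc n) (λ j → x j * y j ^ (n ∸ j)) ≈ sumTo n (λ j → x j * y j ^ (n ∸ j)) + x n
  sum-top n x y = +-cong refl (trans (*-cong refl (^-congʳ (y n) (NP.n∸n≡0 n))) (*-identityʳ _))

  cancel-+ : ∀ x s → (x + s) - s ≈ x
  cancel-+ x s = trans (+-assoc x s (- s)) (trans (+-cong refl (-‿inverseʳ s)) (+-identityʳ x))

  cancel-- : ∀ x s → (x - s) + s ≈ x
  cancel-- x s = trans (+-assoc x (- s) s) (trans (+-cong refl (-‿inverseˡ s)) (+-identityʳ x))

  module Weights (q : Carrier) where

    weight : ℕ → ℕ → Carrier
    weight n k = g q (n ∸ k) * q ^ ((n ∸ k) N.* k)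

    private
      fuel-bound : ∀ m j {F} → j N.< m → m ≤ F → m ∸ suc j N.< F
      fuel-bound m j j<m m≤F =
        NP.≤-trans (P.subst (N._≤ m) (∸-suc m j j<m) (NP.m∸n≤m m j)) m≤F

    gFuel-irrelevant : ∀ F F' m → m N.< F → m N.< F' → gFuel q F (suc m) ≈ gFuel q F' (suc m)
    gFuel-irrelevant (suc F) (suc F') m (s≤s m≤F) (s≤s m≤F') =
      +-cong refl (-‿cong (sum-cong m (λ j j<m → *-cong (same j j<m) refl)))
      where
      same : ∀ j → j N.< m → gFuel q F (m ∸ j) ≈ gFuel q F' (m ∸ j)
      same j j<m rewrite ∸-suc m j j<m =
        gFuel-irrelevant F F' (m ∸ suc j) (fuel-bound m j j<m m≤F) (fuel-bound m j j<m m≤F')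

    g-recurrence : ∀ m → g q (suc m) ≈ 1# - sumTo m (λ j → weight (suc m) (suc j))
    g-recurrence m = +-cong refl (-‿cong (sum-cong m (λ j j<m → *-cong (same j j<m) refl)))
      where
      same : ∀ j → j N.< m → gFuel q m (m ∸ j) ≈ g q (m ∸ j)
      same j j<m rewrite ∸-suc m j j<m =
        gFuel-irrelevant m (suc (m ∸ suc j)) (m ∸ suc j) (fuel-bound m j j<m NP.≤-refl) NP.≤-refl

    -- Σ_{k<n} w_n(k) = 1 for n ≥ 1: the k = 0 term is g_n, the rest is what it subtracts.
    weights-sum-to-one : ∀ n → 1 ≤ n → sumTo n (weight n) ≈ 1#
    weights-sum-to-one (suc m) _ = begin
        sumTo (suc m) (weight (suc m))
      ≈⟨ sum-head m _ ⟩
        g q (suc m) * q ^ (suc m N.* 0) + S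
      ≈⟨ +-cong (trans (*-cong refl (^-congʳ q (NP.*-zeroʳ (suc m)))) (*-identityʳ _)) refl ⟩
        g q (suc m) + S
      ≈⟨ +-cong (g-recurrence m) refl ⟩
        (1# - S) + S
      ≈⟨ cancel-- 1# S ⟩
        1# ∎
      where
      S : Carrier
      S = sumTo m (λ j → weight (suc m) (suc j))

  module Tails (a : Carrier) (A : Series) where

    private
      trunc-inside : ∀ k j → j ≤ k → trunc k A j ≡ A j
      trunc-inside k j j≤k with j ≤ᵇ k | NP.≤⇒≤ᵇ j≤k
      ... | true | _ = P.refl

      trunc-outside : ∀ k j → k N.< j → trunc k A j ≡ 0#
      trunc-outside k j k<j with j ≤ᵇ k | NP.≤ᵇ⇒≤ j k
      ... | false | _   = P.refl
      ... | true  | j≤k = ⊥-elim (NP.<⇒≱ k<j (j≤k tt))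

    truncation-coefficient : ∀ k n → k ≤ n →
      (trunc k A ⊛ geom a) n ≈ a ^ (n ∸ k) * (A ⊛ geom a) k
    truncation-coefficient k n k≤n = begin
        sumTo (suc n) term
      ≈⟨ sum-length term length ⟩
        sumTo ((n ∸ k) N.+ suc k) term
      ≈⟨ sum-vanishing-tail (suc k) (n ∸ k) term
           (λ j k<j → trans (*-cong (reflexive (trunc-outside k j k<j)) refl) (zeroˡ _)) ⟩
        sumTo (suc k) term
      ≈⟨ sum-cong (suc k) (λ j j<1+k → factor j (NP.≤-pred j<1+k)) ⟩
        sumTo (suc k) (λ j → a ^ (n ∸ k) * (A j * a ^ (k ∸ j)))
      ≈⟨ sum-*ˡ (suc k) _ _ ⟩
        a ^ (n ∸ k) * (A ⊛ geom a) k ∎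
      where
      term : ℕ → Carrier
      term j = trunc k A j * a ^ (n ∸ j)
      length : suc n ≡ (n ∸ k) N.+ suc k
      length = P.trans (P.cong suc (P.sym (NP.m∸n+n≡m k≤n))) (P.sym (NP.+-suc (n ∸ k) k))
      exponent : ∀ j → j ≤ k → n ∸ j ≡ (n ∸ k) N.+ (k ∸ j)
      exponent j j≤k = P.trans (P.cong (_∸ j) (P.sym (NP.m∸n+n≡m k≤n))) (NP.+-∸-assoc (n ∸ k) j≤k)
      factor : ∀ j → j ≤ k → term j ≈ a ^ (n ∸ k) * (A j * a ^ (k ∸ j))
      factor j j≤k = begin
          trunc k A j * a ^ (n ∸ j)
        ≈⟨ *-cong (reflexive (trunc-inside k j j≤k)) (^-congʳ a (exponent j j≤k)) ⟩
          A j * a ^ ((n ∸ k) N.+ (k ∸ j))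
        ≈⟨ *-cong refl (^-homo-* a (n ∸ k) (k ∸ j)) ⟩
          A j * (a ^ (n ∸ k) * a ^ (k ∸ j))
        ≈⟨ M.solve 3 (λ x y z → (x ⊙ (y ⊙ z)) ⊜ (y ⊙ (x ⊙ z))) refl _ _ _ ⟩
          a ^ (n ∸ k) * (A j * a ^ (k ∸ j)) ∎

    tail-coefficient : ∀ k n → k ≤ n →
      (tailFrom k A ⊛ geom a) n ≈ (A ⊛ geom a) n - a ^ (n ∸ k) * (A ⊛ geom a) k
    tail-coefficient k n k≤n = begin
        sumTo (suc n) (λ j → (A j - trunc k A j) * a ^ (n ∸ j))
      ≈⟨ sum-cong (suc n) (λ j _ → trans (distribʳ _ _ _) (+-cong refl (sym (-‿distribˡ-* _ _)))) ⟩
        sumTo (suc n) (λ j → A j * a ^ (n ∸ j) + - (trunc k A j * a ^ (n ∸ j)))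
      ≈⟨ sum-+ (suc n) _ _ ⟩
        (A ⊛ geom a) n + sumTo (suc n) (λ j → - (trunc k A j * a ^ (n ∸ j)))
      ≈⟨ +-cong refl (trans (sum-neg (suc n) _) (-‿cong (truncation-coefficient k n k≤n))) ⟩
        (A ⊛ geom a) n - a ^ (n ∸ k) * (A ⊛ geom a) k ∎

  open Weights public using (weight; weights-sum-to-one)

  weighted-tails : ∀ q a (A : Series) n → 1 ≤ n →
    sumTo n (λ k → weight q n k * (tailFrom k A ⊛ geom a) n) ≈
    (A ⊛ geom a) n - sumTo n (λ k → weight q n k * (a ^ (n ∸ k) * (A ⊛ geom a) k))
  weighted-tails q a A n 1≤n = begin
      sumTo n (λ k → w k * (tailFrom k A ⊛ geom a) n)
    ≈⟨ sum-cong n (λ k k<n → trans (*-cong refl (tail-coefficient k n (NP.<⇒≤ k<n)))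
                              (trans (distribˡ _ _ _) (+-cong refl (sym (-‿distribʳ-* _ _))))) ⟩
      sumTo n (λ k → w k * B n + - (w k * (a ^ (n ∸ k) * B k)))
    ≈⟨ sum-+ n _ _ ⟩
      sumTo n (λ k → w k * B n) + sumTo n (λ k → - (w k * (a ^ (n ∸ k) * B k)))
    ≈⟨ +-cong (sum-*ʳ n (B n) w) (sum-neg n _) ⟩
      sumTo n w * B n - sumTo n (λ k → w k * (a ^ (n ∸ k) * B k))
    ≈⟨ +-cong (trans (*-cong (weights-sum-to-one q n 1≤n) refl) (*-identityˡ _)) refl ⟩
      B n - sumTo n (λ k → w k * (a ^ (n ∸ k) * B k)) ∎
    where
    open Tails a A using (tail-coefficient)
    w : ℕ → Carrier
    w = weight q n
    B : Series
    B = A ⊛ geom a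

  module Expansion (q a : Carrier) (C : Series) where

    ratio : ℕ → Carrier
    ratio j = a * q ^ j

    expansion : Series
    expansion m = sumTo (suc m) (λ j → C j * ratio j ^ (m ∸ j))

    expansion-coefficient : ∀ m →
      sumSeries (λ n → shift n (C n · geom (ratio n))) m ≈ expansion m
    expansion-coefficient m =
      sum-cong (suc m) (λ n n<1+m → reflexive (shift-coefficient n _ m (NP.≤-pred n<1+m)))
      where
      shift-coefficient : ∀ n (f : Series) m → n ≤ m → shift n f m ≡ f (m ∸ n)
      shift-coefficient zero    f m       _       = P.refl
      shift-coefficient (suc n) f (suc m) (s≤s p) = shift-coefficient n f m p

    ratio-power : ∀ j i → ratio j ^ i ≈ a ^ i * q ^ (j N.* i)
    ratio-power j i = trans (^-distrib-* a (q ^ j) i) (*-cong refl (^-assocʳ q j i))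

    -- The factorisation behind the inversion, with r = n - j - i:
    -- q^{r(j+i)} a^r (a q^j)^i = (a q^j)^{r+i} q^{ri}.
    reindex : ∀ r i j G →
      (G * q ^ (r N.* (j N.+ i))) * (a ^ r * (C j * ratio j ^ i)) ≈
      (C j * ratio j ^ (r N.+ i)) * (G * q ^ (r N.* i))
    reindex r i j G = begin
        (G * q ^ (r N.* (j N.+ i))) * (a ^ r * (C j * ratio j ^ i))
      ≈⟨ *-cong (*-cong refl split) refl ⟩
        (G * (q ^ (j N.* r) * q ^ (r N.* i))) * (a ^ r * (C j * ratio j ^ i))
      ≈⟨ M.solve 6 (λ g qjr qri ar cj xi →
           ((g ⊙ (qjr ⊙ qri)) ⊙ (ar ⊙ (cj ⊙ xi))) ⊜ ((cj ⊙ ((ar ⊙ qjr) ⊙ xi)) ⊙ (g ⊙ qri)))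
           refl G _ _ _ _ _ ⟩
        (C j * ((a ^ r * q ^ (j N.* r)) * ratio j ^ i)) * (G * q ^ (r N.* i))
      ≈⟨ *-cong (*-cong refl (trans (*-cong (sym (ratio-power j r)) refl) (sym (^-homo-* (ratio j) r i)))) refl ⟩
        (C j * ratio j ^ (r N.+ i)) * (G * q ^ (r N.* i)) ∎
      where
      split : q ^ (r N.* (j N.+ i)) ≈ q ^ (j N.* r) * q ^ (r N.* i)
      split = trans (^-congʳ q (P.trans (NP.*-distribˡ-+ r j i) (P.cong (N._+ r N.* i) (NP.*-comm r j))))
                    (^-homo-* q (j N.* r) (r N.* i))

    exchanged-term : ∀ n j i → i N.< n ∸ j →
      weight q n (j N.+ i) * (a ^ (n ∸ (j N.+ i)) * (C j * ratio j ^ ((j N.+ i) ∸ j))) ≈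
      (C j * ratio j ^ (n ∸ j)) * weight q (n ∸ j) i
    exchanged-term n j i i<n∸j rewrite P.sym (NP.∸-+-assoc n j i) | NP.m+n∸m≡n j i =
      trans (reindex r i j (g q r))
            (*-cong (*-cong refl (^-congʳ (ratio j) (NP.m∸n+n≡m (NP.<⇒≤ i<n∸j)))) refl)
      where
      r : ℕ
      r = n ∸ j ∸ i

    inversion : ∀ n →
      sumTo n (λ k → weight q n k * (a ^ (n ∸ k) * expansion k)) ≈
      sumTo n (λ j → C j * ratio j ^ (n ∸ j))
    inversion n = begin
        sumTo n (λ k → weight q n k * (a ^ (n ∸ k) * expansion k))
      ≈⟨ sum-cong n (λ k _ → trans (*-cong refl (sym (sum-*ˡ (suc k) _ _))) (sym (sum-*ˡ (suc k) _ _))) ⟩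
        sumTo n (λ k → sumTo (suc k) (λ j → term j k))
      ≈⟨ sum-exchange n term ⟩
        sumTo n (λ j → sumTo (n ∸ j) (λ i → term j (j N.+ i)))
      ≈⟨ sum-cong n (λ j j<n → column j j<n) ⟩
        sumTo n (λ j → C j * ratio j ^ (n ∸ j)) ∎
      where
      term : ℕ → ℕ → Carrier
      term j k = weight q n k * (a ^ (n ∸ k) * (C j * ratio j ^ (k ∸ j)))
      column : ∀ j → j N.< n → sumTo (n ∸ j) (λ i → term j (j N.+ i)) ≈ C j * ratio j ^ (n ∸ j)
      column j j<n = begin
          sumTo (n ∸ j) (λ i → term j (j N.+ i))
        ≈⟨ sum-cong (n ∸ j) (λ i i<n∸j → exchanged-term n j i i<n∸j) ⟩
          sumTo (n ∸ j) (λ i → (C j * ratio j ^ (n ∸ j)) * weight q (n ∸ j) i)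
        ≈⟨ sum-*ˡ (n ∸ j) _ _ ⟩
          (C j * ratio j ^ (n ∸ j)) * sumTo (n ∸ j) (weight q (n ∸ j))
        ≈⟨ *-cong refl (weights-sum-to-one q (n ∸ j) (NP.m<n⇒0<n∸m j<n)) ⟩
          (C j * ratio j ^ (n ∸ j)) * 1#
        ≈⟨ *-identityʳ _ ⟩
          C j * ratio j ^ (n ∸ j) ∎

corollary2p4 : ∀ {c ℓ} (R : CommutativeRing c ℓ) → let open PS R in
    (q a : Carrier) (A C : ℕ → Carrier) →
    (∀ m → (A ⊛ geom a) m ≈ sumSeries (λ n → shift n (C n · geom (a * q ^ n))) m) →
    (C 0 ≈ A 0) ×
    (∀ n → 1 ≤ n →
    C n ≈ sumTo n (λ k → (g q (n ∸ k) * q ^ ((n ∸ k) Data.Nat.* k)) * (tailFrom k A ⊛ geom a) n))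
corollary2p4 R q a A C hyp = constant-term , coefficient
  where
  open PS R
  open Relation.Binary.Reasoning.Setoid setoid
  open Development R
  open Expansion q a C

  B≈E : ∀ m → (A ⊛ geom a) m ≈ expansion m
  B≈E m = trans (hyp m) (expansion-coefficient m)

  constant-term : C 0 ≈ A 0
  constant-term = begin
      C 0                ≈⟨ +-identityˡ (C 0) ⟨
      0# + C 0           ≈⟨ sum-top 0 C ratio ⟨
      expansion 0        ≈⟨ B≈E 0 ⟨
      (A ⊛ geom a) 0     ≈⟨ sum-top 0 A (λ _ → a) ⟩
      0# + A 0           ≈⟨ +-identityˡ (A 0) ⟩
      A 0 ∎

  coefficient : ∀ n → 1 ≤ n →
    C n ≈ sumTo n (λ k → weight q n k * (tailFrom k A ⊛ geom a) n)
  coefficient n 1≤n = sym (begin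
      sumTo n (λ k → weight q n k * (tailFrom k A ⊛ geom a) n)
    ≈⟨ weighted-tails q a A n 1≤n ⟩
      (A ⊛ geom a) n - sumTo n (λ k → weight q n k * (a ^ (n ∸ k) * (A ⊛ geom a) k))
    ≈⟨ +-cong (B≈E n) (-‿cong (sum-cong n (λ k _ → *-cong refl (*-cong refl (B≈E k))))) ⟩
      expansion n - sumTo n (λ k → weight q n k * (a ^ (n ∸ k) * expansion k))
    ≈⟨ +-cong (trans (sum-top n C ratio) (+-comm _ _)) (-‿cong (inversion n)) ⟩
      (C n + Earlier) - Earlier
    ≈⟨ cancel-+ (C n) Earlier ⟩
      C n ∎)
    where
    Earlier : Carrier
    Earlier = sumTo n (λ j → C j * ratio j ^ (n ∸ j))
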